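{- Let $n \ge 1$ and let $k, \ell$ be nonnegative integers. The number of pairs $(T,v)$ with $T \in \mathcal{T}_n$ and $v$ a vertex of $T$ of outdegree at least $k$ and level at least $\ell$ equals $\binom{2n-k}{n+\ell}$.
   Context: $\mathcal{T}_n$ denotes the set of rooted ordered (plane) trees with $n$ edges. The outdegree of a vertex is its number of children; the level of a vertex is its distance (number of edges) from the root. -}

module Defs where

open import Data.Nat using (ℕ; zero; suc; _+_)
open import Data.List using (List; []; _∷_; length; lookup)
open import Data.Fin using (Fin)

data Tree : Set where
  node : List Tree → Tree

mutual
  edges : Tree → ℕ
  edges (node ts) = edgesList ts

  edgesList : List Tree → ℕ
  edgesList []       = 0
  edgesList (t ∷ ts) = suc (edges t) + edgesList ts

data Vertex : Tree → Set where
  root  : ∀ {ts} → Vertex (node ts)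
  child : ∀ {ts} (i : Fin (length ts)) → Vertex (lookup ts i) → Vertex (node ts)

outdeg : ∀ {t} → Vertex t → ℕ
outdeg {node ts} root = length ts
outdeg (child i v)    = outdeg v

level : ∀ {t} → Vertex t → ℕ
level root        = 0
level (child i v) = suc (level v)

-- A vertex v of a plane tree is encoded by its zipper: the pairs (L , R) of
-- left and right siblings along the path from the root to v, together with
-- the children of v.  Edges, level and outdegree become the weight, depth and
-- arity of the zipper.  Let A(n,k,ℓ) be the zippers of weight n, arity ≥ k
-- and depth ≥ ℓ, and E(n,k,ℓ) those of arity exactly k, so that
-- A(n,k,ℓ) = A(n,k+1,ℓ) ⊎ E(n,k,ℓ).  Three bijections reduce E to A:
--   E(n,k,ℓ+1) ≅ A(n,k+1,ℓ): mark the parent instead, giving it as children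
--     the old children, then a new vertex adopting the left siblings, then
--     the right siblings;
--   E(n+1,k+1,ℓ) ≅ A(n,k,ℓ): contract the edge to the last child;
--   E(n+1,0,0) = E(n+1,0,1): a leaf of a nonempty tree is not the root.
-- In each case 2n − k drops by one, and Pascal's rule gives C(2n − k, n + ℓ)
-- by induction.

module Submission where

open import Defs
open import Data.Nat using (ℕ; zero; suc; pred; _+_; _*_; _∸_; _≤_; _<_; z≤n; s≤s; s≤s⁻¹; z<s; _≤?_)
open import Data.Nat.Properties
open import Data.Nat.Combinatorics using (_C_; nCk+nC[k+1]≡[n+1]C[k+1]; nCk≡nC[n∸k])
open import Data.Nat.Tactic.RingSolver using (solve-∀)
open import Data.Fin using (Fin; toℕ) renaming (zero to fzero; suc to fsuc)
open import Data.Fin.Properties using (+↔⊎)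
open import Data.List using (List; []; _∷_; _++_; length; lookup; take; drop)
open import Data.List.Properties using (length-++)
open import Data.Product using (Σ; Σ-syntax; _×_; _,_; proj₁; proj₂)
open import Data.Product.Properties using (Σ-≡,≡→≡)
open import Data.Product.Function.Dependent.Propositional using (Σ-↔)
open import Data.Sum using (_⊎_; inj₁; inj₂; [_,_])
open import Data.Sum.Function.Propositional using (_⊎-↔_)
open import Data.Sum.Algebra using (⊎-comm)
open import Function using (_∘_)
open import Function.Bundles using (_↔_; mk↔ₛ′)
open import Function.Properties.Inverse using (↔-refl; ↔-sym; ↔-trans)
open import Function.Related.TypeIsomorphisms using (Σ-distribˡ-⊎)
open import Relation.Nullary using (Irrelevant; ¬_; yes; no; contradiction)
open import Relation.Binary.PropositionalEquality using (_≡_; refl; sym; trans; cong; subst; module ≡-Reasoning)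

Fin-cong : ∀ {m n} → m ≡ n → Fin m ↔ Fin n
Fin-cong refl = ↔-refl

Fin-pascal : ∀ {A B : Set} N j → A ↔ Fin (N C suc j) → B ↔ Fin (N C j) →
             (A ⊎ B) ↔ Fin (suc N C suc j)
Fin-pascal N j A↔ B↔ =
  ↔-trans (A↔ ⊎-↔ B↔)
  (↔-trans (⊎-comm _ _)
  (↔-trans (↔-sym +↔⊎) (Fin-cong (nCk+nC[k+1]≡[n+1]C[k+1] N j))))

uninhabited↔Fin0 : ∀ {A : Set} → ¬ A → A ↔ Fin 0
uninhabited↔Fin0 ¬a = mk↔ₛ′ (λ a → contradiction a ¬a) (λ ()) (λ ()) (λ a → contradiction a ¬a)

prop-↔ : ∀ {A B : Set} → Irrelevant A → Irrelevant B → (A → B) → (B → A) → A ↔ B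
prop-↔ A-irr B-irr f g = mk↔ₛ′ f g (λ _ → B-irr _ _) (λ _ → A-irr _ _)

Σ-cong-↔ : ∀ {A : Set} {P Q : A → Set} → (∀ a → P a ↔ Q a) → Σ A P ↔ Σ A Q
Σ-cong-↔ P↔Q = Σ-↔ ↔-refl (λ {a} → P↔Q a)

⊎-irrelevant : ∀ {A B : Set} → Irrelevant A → Irrelevant B → (A → ¬ B) → Irrelevant (A ⊎ B)
⊎-irrelevant A-irr B-irr disjoint (inj₁ a) (inj₁ a′) = cong inj₁ (A-irr a a′)
⊎-irrelevant A-irr B-irr disjoint (inj₁ a) (inj₂ b)  = contradiction b (disjoint a)
⊎-irrelevant A-irr B-irr disjoint (inj₂ b) (inj₁ a)  = contradiction b (disjoint a)
⊎-irrelevant A-irr B-irr disjoint (inj₂ b) (inj₂ b′) = cong inj₂ (B-irr b b′)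

Σ-restrict-↔ : ∀ {A B : Set} {P : A → Set} {Q : B → Set} →
               (∀ a → Irrelevant (P a)) → (∀ b → Irrelevant (Q b)) →
               (f : A → B) (g : B → A) →
               (∀ a → P a → Q (f a)) → (∀ b → Q b → P (g b)) →
               (∀ a → P a → g (f a) ≡ a) → (∀ b → Q b → f (g b) ≡ b) →
               Σ A P ↔ Σ B Q
Σ-restrict-↔ P-irr Q-irr f g f-P g-Q g∘f f∘g = mk↔ₛ′
  (λ (a , p) → f a , f-P a p)
  (λ (b , q) → g b , g-Q b q)
  (λ (b , q) → Σ-≡,≡→≡ (f∘g b q , Q-irr _ _ _))
  (λ (a , p) → Σ-≡,≡→≡ (g∘f a p , P-irr _ _ _))

edgesList-++ : ∀ ts us → edgesList (ts ++ us) ≡ edgesList ts + edgesList us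
edgesList-++ []       us = refl
edgesList-++ (t ∷ ts) us =
  trans (cong (suc (edges t) +_) (edgesList-++ ts us)) (sym (+-assoc (suc (edges t)) (edgesList ts) _))

length≤edgesList : ∀ ts → length ts ≤ edgesList ts
length≤edgesList []       = z≤n
length≤edgesList (t ∷ ts) = s≤s (≤-trans (length≤edgesList ts) (m≤n+m _ (edges t)))

Frame : Set
Frame = List Tree × List Tree

record Zipper : Set where
  constructor zipper
  field
    path     : List Frame
    children : List Tree
open Zipper

plug : List Frame → Tree → Tree
plug []              t = t
plug ((L , R) ∷ fs) t = node (L ++ plug fs t ∷ R)

pathEdges : List Frame → ℕ
pathEdges []              = 0
pathEdges ((L , R) ∷ fs) = suc (edgesList L + edgesList R) + pathEdges fs

weight arity depth : Zipper → ℕ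
weight z = edgesList (children z) + pathEdges (path z)
arity  z = length (children z)
depth  z = length (path z)

edges-plug : ∀ fs t → edges (plug fs t) ≡ edges t + pathEdges fs
edges-plug []              t = sym (+-identityʳ (edges t))
edges-plug ((L , R) ∷ fs) t = begin
  edgesList (L ++ plug fs t ∷ R)                            ≡⟨ edgesList-++ L _ ⟩
  edgesList L + (suc (edges (plug fs t)) + edgesList R)     ≡⟨ cong (λ e → edgesList L + (suc e + edgesList R)) (edges-plug fs t) ⟩
  edgesList L + (suc (edges t + pathEdges fs) + edgesList R) ≡⟨ rearrange (edgesList L) (edges t) (pathEdges fs) (edgesList R) ⟩
  edges t + (suc (edgesList L + edgesList R) + pathEdges fs) ∎
  where
  open ≡-Reasoning
  rearrange : ∀ a b c d → a + (suc (b + c) + d) ≡ b + (suc (a + d) + c)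
  rearrange = solve-∀

length≤pathEdges : ∀ fs → length fs ≤ pathEdges fs
length≤pathEdges []              = z≤n
length≤pathEdges ((L , R) ∷ fs) = s≤s (≤-trans (length≤pathEdges fs) (m≤n+m _ _))

arity+depth≤weight : ∀ z → arity z + depth z ≤ weight z
arity+depth≤weight (zipper fs ts) = +-mono-≤ (length≤edgesList ts) (length≤pathEdges fs)

shift : ∀ {ts} t → Vertex (node ts) → Vertex (node (t ∷ ts))
shift t root        = root
shift t (child i v) = child (fsuc i) v

childAt : ∀ L R {t} → Vertex t → Vertex (node (L ++ t ∷ R))
childAt []      R v = child fzero v
childAt (u ∷ L) R v = shift u (childAt L R v)

focus : ∀ fs {t} → Vertex t → Vertex (plug fs t)
focus []              v = v
focus ((L , R) ∷ fs) v = childAt L R (focus fs v)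

zip : Zipper → Σ Tree Vertex
zip (zipper fs ts) = plug fs (node ts) , focus fs root

inContext : List Tree → List Tree → Σ Tree Vertex → Σ Tree Vertex
inContext L R (t , v) = node (L ++ t ∷ R) , childAt L R v

enter : Frame → Zipper → Zipper
enter f (zipper fs ts) = zipper (f ∷ fs) ts

unzip : ∀ {t} → Vertex t → Zipper
unzip {node ts} root        = zipper [] ts
unzip {node ts} (child i v) = enter (take (toℕ i) ts , drop (suc (toℕ i)) ts) (unzip v)

inContext-take-drop : ∀ ts (i : Fin (length ts)) (v : Vertex (lookup ts i)) →
  inContext (take (toℕ i) ts) (drop (suc (toℕ i)) ts) (lookup ts i , v) ≡ (node ts , child i v)
inContext-take-drop (t ∷ ts) fzero    v = refl
inContext-take-drop (t ∷ ts) (fsuc i) v = cong shiftΣ (inContext-take-drop ts i v)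
  where
  shiftΣ : Σ Tree Vertex → Σ Tree Vertex
  shiftΣ (node us , w) = node (t ∷ us) , shift t w

zip-unzip : ∀ {t} (v : Vertex t) → zip (unzip v) ≡ (t , v)
zip-unzip {node ts} root        = refl
zip-unzip {node ts} (child i v) =
  trans (cong (inContext (take (toℕ i) ts) (drop (suc (toℕ i)) ts)) (zip-unzip v))
        (inContext-take-drop ts i v)

consLeft : Tree → Zipper → Zipper
consLeft u (zipper []              ts) = zipper [] (u ∷ ts)
consLeft u (zipper ((L , R) ∷ fs) ts) = zipper ((u ∷ L , R) ∷ fs) ts

unzip-shift : ∀ {ts} u (v : Vertex (node ts)) → unzip (shift u v) ≡ consLeft u (unzip v)
unzip-shift u root        = refl
unzip-shift u (child i v) = refl

unzip-childAt : ∀ L R {t} (v : Vertex t) → unzip (childAt L R v) ≡ enter (L , R) (unzip v)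
unzip-childAt []      R v = refl
unzip-childAt (u ∷ L) R v =
  trans (unzip-shift u (childAt L R v)) (cong (consLeft u) (unzip-childAt L R v))

unzip-zip : ∀ z → unzip (proj₂ (zip z)) ≡ z
unzip-zip (zipper []              ts) = refl
unzip-zip (zipper ((L , R) ∷ fs) ts) =
  trans (unzip-childAt L R (focus fs root)) (cong (enter (L , R)) (unzip-zip (zipper fs ts)))

vertex↔zipper : Σ Tree Vertex ↔ Zipper
vertex↔zipper = mk↔ₛ′ (unzip ∘ proj₂) zip unzip-zip (λ (t , v) → zip-unzip v)

edges-unzip : ∀ {t} (v : Vertex t) → edges t ≡ weight (unzip v)
edges-unzip {t} v = trans (cong (edges ∘ proj₁) (sym (zip-unzip v))) (edges-plug (path z) (node (children z)))
  where z = unzip v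

outdeg-unzip : ∀ {t} (v : Vertex t) → outdeg v ≡ arity (unzip v)
outdeg-unzip {node ts} root        = refl
outdeg-unzip {node ts} (child i v) = outdeg-unzip v

level-unzip : ∀ {t} (v : Vertex t) → level v ≡ depth (unzip v)
level-unzip {node ts} root        = refl
level-unzip {node ts} (child i v) = cong suc (level-unzip v)

AtLeast Exactly : ℕ → ℕ → ℕ → Zipper → Set
AtLeast n k ℓ z = weight z ≡ n × k ≤ arity z × ℓ ≤ depth z
Exactly n k ℓ z = weight z ≡ n × arity z ≡ k × ℓ ≤ depth z

atLeast-irrelevant : ∀ {n k ℓ} z → Irrelevant (AtLeast n k ℓ z)
atLeast-irrelevant _ (w , a , d) (w′ , a′ , d′)
  rewrite ≡-irrelevant w w′ | ≤-irrelevant a a′ | ≤-irrelevant d d′ = refl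

exactly-irrelevant : ∀ {n k ℓ} z → Irrelevant (Exactly n k ℓ z)
exactly-irrelevant _ (w , a , d) (w′ , a′ , d′)
  rewrite ≡-irrelevant w w′ | ≡-irrelevant a a′ | ≤-irrelevant d d′ = refl

markedVertices↔atLeast : ∀ n k ℓ →
  (Σ[ T ∈ Tree ] Σ[ _ ∈ edges T ≡ n ] Σ[ v ∈ Vertex T ] (k ≤ outdeg v × ℓ ≤ level v))
    ↔ Σ Zipper (AtLeast n k ℓ)
markedVertices↔atLeast n k ℓ =
  ↔-trans (mk↔ₛ′ (λ (T , e , v , p) → (T , v) , e , p) (λ ((T , v) , e , p) → T , e , v , p)
                 (λ _ → refl) (λ _ → refl))
          (Σ-↔ vertex↔zipper conditions)
  where
  conditions : ∀ {x : Σ Tree Vertex} →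
    (edges (proj₁ x) ≡ n × k ≤ outdeg (proj₂ x) × ℓ ≤ level (proj₂ x)) ↔ AtLeast n k ℓ (unzip (proj₂ x))
  conditions {T , v} rewrite edges-unzip v | outdeg-unzip v | level-unzip v = ↔-refl

atLeast-bound : ∀ {n k ℓ} z → AtLeast n k ℓ z → k + ℓ ≤ n
atLeast-bound z (refl , a , d) = ≤-trans (+-mono-≤ a d) (arity+depth≤weight z)

uninhabited-↔ : ∀ {n k ℓ} → n < k + ℓ → Σ Zipper (AtLeast n k ℓ) ↔ Fin 0
uninhabited-↔ n<k+ℓ = uninhabited↔Fin0 (λ (z , p) → <⇒≱ n<k+ℓ (atLeast-bound z p))

weight≡0⇒trivial : ∀ z → weight z ≡ 0 → z ≡ zipper [] []
weight≡0⇒trivial (zipper []      [])      _  = refl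
weight≡0⇒trivial (zipper []      (_ ∷ _)) ()
weight≡0⇒trivial (zipper (_ ∷ _) [])      ()
weight≡0⇒trivial (zipper (_ ∷ _) (_ ∷ _)) ()

trivial-↔ : Σ Zipper (AtLeast 0 0 0) ↔ Fin 1
trivial-↔ = mk↔ₛ′ (λ _ → fzero) (λ _ → zipper [] [] , refl , z≤n , z≤n)
  (λ { fzero → refl ; (fsuc ()) })
  (λ (z , w , _) → Σ-≡,≡→≡ (sym (weight≡0⇒trivial z w) , atLeast-irrelevant z _ _))

atLeast-split : ∀ {n k ℓ} →
  Σ Zipper (AtLeast n k ℓ) ↔ (Σ Zipper (AtLeast n (suc k) ℓ) ⊎ Σ Zipper (Exactly n k ℓ))
atLeast-split {n} {k} {ℓ} = ↔-trans (Σ-cong-↔ pointwise) Σ-distribˡ-⊎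
  where
  pointwise : ∀ z → AtLeast n k ℓ z ↔ (AtLeast n (suc k) ℓ z ⊎ Exactly n k ℓ z)
  pointwise z = prop-↔ (atLeast-irrelevant z)
    (⊎-irrelevant (atLeast-irrelevant z) (exactly-irrelevant z)
      (λ (_ , k<a , _) (_ , a≡k , _) → <-irrefl (sym a≡k) k<a))
    split
    [ (λ (w , k<a , d) → w , <⇒≤ k<a , d) , (λ (w , a≡k , d) → w , ≤-reflexive (sym a≡k) , d) ]
    where
    split : AtLeast n k ℓ z → AtLeast n (suc k) ℓ z ⊎ Exactly n k ℓ z
    split (w , k≤a , d) with suc k ≤? arity z
    ... | yes k<a = inj₁ (w , k<a , d)
    ... | no  k≮a = inj₂ (w , ≤-antisym (≮⇒≥ k≮a) k≤a , d)

consChild : Tree → Zipper → Zipper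
consChild t (zipper fs ts) = zipper fs (t ∷ ts)

ascend : Zipper → Zipper
ascend (zipper []              ts) = zipper [] ts
ascend (zipper ((L , R) ∷ fs) ts) = zipper fs (ts ++ node L ∷ R)

descend : ℕ → Zipper → Zipper
descend zero    (zipper fs (node L ∷ R)) = zipper ((L , R) ∷ fs) []
descend (suc k) (zipper fs (t ∷ ts))     = consChild t (descend k (zipper fs ts))
descend _       z                        = z

ascend-consChild : ∀ t z → ascend (consChild t z) ≡ consChild t (ascend z)
ascend-consChild t (zipper []      ts) = refl
ascend-consChild t (zipper (_ ∷ _) ts) = refl

ascend-descend : ∀ k fs ts → k < length ts → ascend (descend k (zipper fs ts)) ≡ zipper fs ts
ascend-descend zero    fs (node L ∷ R) _         = refl
ascend-descend (suc k) fs (t ∷ ts)     (s≤s k<l) =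
  trans (ascend-consChild t _) (cong (consChild t) (ascend-descend k fs ts k<l))

descend-ascend : ∀ fs L R ts → descend (length ts) (ascend (zipper ((L , R) ∷ fs) ts)) ≡ zipper ((L , R) ∷ fs) ts
descend-ascend fs L R []       = refl
descend-ascend fs L R (t ∷ ts) = cong (consChild t) (descend-ascend fs L R ts)

arity-descend : ∀ k fs ts → k < length ts → arity (descend k (zipper fs ts)) ≡ k
arity-descend zero    fs (node L ∷ R) _         = refl
arity-descend (suc k) fs (t ∷ ts)     (s≤s k<l) = cong suc (arity-descend k fs ts k<l)

depth-descend : ∀ k fs ts → k < length ts → depth (descend k (zipper fs ts)) ≡ suc (length fs)
depth-descend zero    fs (node L ∷ R) _         = refl
depth-descend (suc k) fs (t ∷ ts)     (s≤s k<l) = depth-descend k fs ts k<l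

depth-ascend : ∀ z → depth (ascend z) ≡ pred (depth z)
depth-ascend (zipper []      ts) = refl
depth-ascend (zipper (_ ∷ _) ts) = refl

arity-ascend : ∀ z → 0 < depth z → arity z < arity (ascend z)
arity-ascend (zipper ((L , R) ∷ fs) ts) _ = subst (length ts <_) (sym (length-++ ts)) (m<m+n (length ts) z<s)

weight-ascend : ∀ z → 0 < depth z → weight (ascend z) ≡ weight z
weight-ascend (zipper ((L , R) ∷ fs) ts) _ =
  trans (cong (_+ pathEdges fs) (edgesList-++ ts (node L ∷ R))) (+-assoc (edgesList ts) _ (pathEdges fs))

weight-descend : ∀ k fs ts → k < length ts → weight (descend k (zipper fs ts)) ≡ weight (zipper fs ts)
weight-descend k fs ts k<l = begin
  weight (descend k (zipper fs ts))          ≡⟨ sym (weight-ascend (descend k (zipper fs ts)) (subst (0 <_) (sym (depth-descend k fs ts k<l)) z<s)) ⟩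
  weight (ascend (descend k (zipper fs ts))) ≡⟨ cong weight (ascend-descend k fs ts k<l) ⟩
  weight (zipper fs ts)                      ∎
  where open ≡-Reasoning

ascend-↔ : ∀ {n k ℓ} → Σ Zipper (Exactly n k (suc ℓ)) ↔ Σ Zipper (AtLeast n (suc k) ℓ)
ascend-↔ {n} {k} {ℓ} =
  Σ-restrict-↔ exactly-irrelevant atLeast-irrelevant ascend (descend k) up down descend∘ascend ascend∘descend
  where
  up : ∀ z → Exactly n k (suc ℓ) z → AtLeast n (suc k) ℓ (ascend z)
  up z (w , a≡k , d) =
    trans (weight-ascend z (≤-trans z<s d)) w ,
    subst (_< arity (ascend z)) a≡k (arity-ascend z (≤-trans z<s d)) ,
    subst (ℓ ≤_) (sym (depth-ascend z)) (<⇒≤pred d)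
  down : ∀ z → AtLeast n (suc k) ℓ z → Exactly n k (suc ℓ) (descend k z)
  down (zipper fs ts) (w , k<a , d) =
    trans (weight-descend k fs ts k<a) w ,
    arity-descend k fs ts k<a ,
    subst (suc ℓ ≤_) (sym (depth-descend k fs ts k<a)) (s≤s d)
  descend∘ascend : ∀ z → Exactly n k (suc ℓ) z → descend k (ascend z) ≡ z
  descend∘ascend (zipper ((L , R) ∷ fs) ts) (_ , a≡k , _) =
    subst (λ j → descend j (ascend (zipper ((L , R) ∷ fs) ts)) ≡ zipper ((L , R) ∷ fs) ts) a≡k
          (descend-ascend fs L R ts)
  ascend∘descend : ∀ z → AtLeast n (suc k) ℓ z → ascend (descend k z) ≡ z
  ascend∘descend (zipper fs ts) (_ , k<a , _) = ascend-descend k fs ts k<a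

subtrees : Tree → List Tree
subtrees (node ts) = ts

contractLast : List Tree → List Tree
contractLast []           = []
contractLast (t ∷ [])     = subtrees t
contractLast (t ∷ u ∷ ts) = t ∷ contractLast (u ∷ ts)

adoptFrom : ℕ → List Tree → List Tree
adoptFrom zero    ts       = node ts ∷ []
adoptFrom (suc k) []       = node [] ∷ []
adoptFrom (suc k) (t ∷ ts) = t ∷ adoptFrom k ts

contractLast-adoptFrom : ∀ k ts → contractLast (adoptFrom k ts) ≡ ts
contractLast-adoptFrom zero          ts           = refl
contractLast-adoptFrom (suc k)       []           = refl
contractLast-adoptFrom (suc zero)    (t ∷ ts)     = refl
contractLast-adoptFrom (suc (suc k)) (t ∷ [])     = refl
contractLast-adoptFrom (suc (suc k)) (t ∷ u ∷ ts) = cong (t ∷_) (contractLast-adoptFrom (suc k) (u ∷ ts))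

adoptFrom-contractLast : ∀ k ts → length ts ≡ suc k → adoptFrom k (contractLast ts) ≡ ts
adoptFrom-contractLast zero    (node us ∷ []) _ = refl
adoptFrom-contractLast (suc k) (t ∷ u ∷ ts)   l = cong (t ∷_) (adoptFrom-contractLast k (u ∷ ts) (suc-injective l))

length-adoptFrom : ∀ k ts → k ≤ length ts → length (adoptFrom k ts) ≡ suc k
length-adoptFrom zero    ts       _         = refl
length-adoptFrom (suc k) (t ∷ ts) (s≤s k≤l) = cong suc (length-adoptFrom k ts k≤l)

length≤suc-length-contractLast : ∀ ts → length ts ≤ suc (length (contractLast ts))
length≤suc-length-contractLast []           = z≤n
length≤suc-length-contractLast (_ ∷ [])     = s≤s z≤n
length≤suc-length-contractLast (t ∷ u ∷ ts) = s≤s (length≤suc-length-contractLast (u ∷ ts))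

edgesList-adoptFrom : ∀ k ts → edgesList (adoptFrom k ts) ≡ suc (edgesList ts)
edgesList-adoptFrom zero    ts       = cong suc (+-identityʳ (edgesList ts))
edgesList-adoptFrom (suc k) []       = refl
edgesList-adoptFrom (suc k) (t ∷ ts) =
  trans (cong (suc (edges t) +_) (edgesList-adoptFrom k ts)) (+-suc (suc (edges t)) (edgesList ts))

contract-↔ : ∀ {n k ℓ} → Σ Zipper (Exactly (suc n) (suc k) ℓ) ↔ Σ Zipper (AtLeast n k ℓ)
contract-↔ {n} {k} {ℓ} =
  Σ-restrict-↔ exactly-irrelevant atLeast-irrelevant (onChildren contractLast) (onChildren (adoptFrom k))
               contracted adopted
               (λ { (zipper fs ts) (_ , l , _) → cong (zipper fs) (adoptFrom-contractLast k ts l) })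
               (λ { (zipper fs ts) _ → cong (zipper fs) (contractLast-adoptFrom k ts) })
  where
  onChildren : (List Tree → List Tree) → Zipper → Zipper
  onChildren f (zipper fs ts) = zipper fs (f ts)
  contracted : ∀ z → Exactly (suc n) (suc k) ℓ z → AtLeast n k ℓ (onChildren contractLast z)
  contracted (zipper fs ts) (w , l , d) =
    suc-injective (trans (cong (_+ pathEdges fs) edges-contracted) w) ,
    s≤s⁻¹ (subst (_≤ suc (length (contractLast ts))) l (length≤suc-length-contractLast ts)) ,
    d
    where
    edges-contracted : suc (edgesList (contractLast ts)) ≡ edgesList ts
    edges-contracted = trans (sym (edgesList-adoptFrom k (contractLast ts)))
                             (cong edgesList (adoptFrom-contractLast k ts l))
  adopted : ∀ z → AtLeast n k ℓ z → Exactly (suc n) (suc k) ℓ (onChildren (adoptFrom k) z)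
  adopted (zipper fs ts) (w , k≤a , d) =
    trans (cong (_+ pathEdges fs) (edgesList-adoptFrom k ts)) (cong suc w) ,
    length-adoptFrom k ts k≤a ,
    d

leaf-below-root : ∀ {n} z → weight z ≡ suc n → arity z ≡ 0 → 0 < depth z
leaf-below-root (zipper []      [])      () _
leaf-below-root (zipper []      (_ ∷ _)) _  ()
leaf-below-root (zipper (_ ∷ _) _)       _  _  = z<s

leaf-↔ : ∀ {n} → Σ Zipper (Exactly (suc n) 0 0) ↔ Σ Zipper (Exactly (suc n) 0 1)
leaf-↔ = Σ-cong-↔ (λ z → prop-↔ (exactly-irrelevant z) (exactly-irrelevant z)
  (λ (w , a , _) → w , a , leaf-below-root z w a)
  (λ (w , a , _) → w , a , z≤n))

[m+1+m]C[m+1]≡[m+1+m]Cm : ∀ m → (m + suc m) C suc m ≡ (m + suc m) C m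
[m+1+m]C[m+1]≡[m+1+m]Cm m =
  sym (trans (nCk≡nC[n∸k] (m≤m+n m (suc m))) (cong ((m + suc m) C_) (m+n∸m≡n m (suc m))))

-- Induction on N = 2n − k, kept as the equation N + k ≡ n + n; the binomial
-- is indexed by ℓ + n so that suc ℓ + n computes to suc (ℓ + n).
count : ∀ N n k ℓ → N + k ≡ n + n → Σ Zipper (AtLeast n k ℓ) ↔ Fin (N C (ℓ + n))
count zero    zero    zero    zero    refl = trivial-↔
count zero    zero    zero    (suc ℓ) refl = uninhabited-↔ z<s
count zero    (suc m) k       ℓ       k≡ =
  ↔-trans (uninhabited-↔ (≤-trans (m<m+n (suc m) z<s) (subst (_≤ k + ℓ) k≡ (m≤m+n k ℓ))))
          (Fin-cong (sym (cong (0 C_) (+-suc ℓ m))))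
count (suc N) n       k       (suc ℓ) eq =
  ↔-trans atLeast-split
    (Fin-pascal N (ℓ + n) (count N n (suc k) (suc ℓ) eq′) (↔-trans ascend-↔ (count N n (suc k) ℓ eq′)))
  where eq′ = trans (+-suc N k) eq
count (suc N) (suc m) (suc k) zero    eq =
  ↔-trans atLeast-split
    (Fin-pascal N m (count N (suc m) (suc (suc k)) zero (trans (+-suc N (suc k)) eq))
                    (↔-trans contract-↔ (count N m k zero eq″)))
  where eq″ = suc-injective (trans (sym (+-suc N k)) (trans (suc-injective eq) (+-suc m m)))
count (suc N) (suc m) zero    zero    eq =
  ↔-trans atLeast-split
    (Fin-pascal N m (count N (suc m) 1 zero eq′)
      (↔-trans leaf-↔ (↔-trans ascend-↔ (↔-trans (count N (suc m) 1 zero eq′) (Fin-cong middle)))))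
  where
  eq′ = trans (+-suc N 0) eq
  middle : N C suc m ≡ N C m
  middle = subst (λ M → M C suc m ≡ M C m) (sym (trans (sym (+-identityʳ N)) (suc-injective eq)))
                 ([m+1+m]C[m+1]≡[m+1+m]Cm m)

atLeast-↔ : ∀ n k ℓ → 1 ≤ n → Σ Zipper (AtLeast n k ℓ) ↔ Fin ((2 * n ∸ k) C (n + ℓ))
atLeast-↔ n@(suc _) k ℓ _ with k ≤? 2 * n
... | yes k≤2n = ↔-trans (count (2 * n ∸ k) n k ℓ (trans (m∸n+n≡m k≤2n) (cong (n +_) (+-identityʳ n))))
                         (Fin-cong (cong ((2 * n ∸ k) C_) (+-comm ℓ n)))
-- Only here is 1 ≤ n needed: for k > 2n the truncated 2n ∸ k is 0, and
-- 0 C (n + ℓ) vanishes only because n + ℓ > 0.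
... | no  k≰2n =
  ↔-trans (uninhabited-↔ (≤-trans (≤-trans (s≤s (m≤m+n n _)) (≰⇒> k≰2n)) (m≤m+n k ℓ)))
          (Fin-cong (cong (_C (n + ℓ)) (sym (m≤n⇒m∸n≡0 (<⇒≤ (≰⇒> k≰2n))))))

lemma4p1 : (n k ℓ : ℕ) → 1 ≤ n →
    Fin ((2 * n ∸ k) C (n + ℓ)) ↔
      (Σ[ T ∈ Tree ] Σ[ _ ∈ edges T ≡ n ] Σ[ v ∈ Vertex T ] (k ≤ outdeg v × ℓ ≤ level v))
lemma4p1 n k ℓ 1≤n = ↔-sym (↔-trans (markedVertices↔atLeast n k ℓ) (atLeast-↔ n k ℓ 1≤n))
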